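{- Let $\delta\ge0$ and $0\le\alpha\le1$, and let $J=(X,k,\mathcal{R}=(R_1,\ldots,R_m))$ be a $(k,5\delta')$-irreducible instance of Binary Constrained Clustering for some $\delta'\ge\delta$. Let the pair $(C_1,B)$, with $B\subseteq X$, $C_1\subseteq\{0,1\}^m$, $|C_1|<k$, be $\delta$-extendable for $J$. Let $C_2=(\mathbf{c}^*_1,\ldots,\mathbf{c}^*_\ell)$ be a good $\delta$-extension of $(C_1,B)$, witnessed by a partition $Z_1\uplus Z_2=X\setminus B$ and a set $I$, and let $J'=(Z_2,\ell=k-|C_1|,\mathcal{R}'=\mathcal{R}(I,C_1))$ be the corresponding $C_2$-optimal reduced instance. Let $X_1,\ldots,X_\ell$ be the clusters corresponding to the solution $C_2$ of $J'$, and let $I'\subseteq\{1,\ldots,\ell\}$, $|I'|=k'$, be the set of indices of the $\frac{k}{\alpha}$-heavy clusters among them. Then for every solution $C'_2=(\mathbf{c}_i)_{i\in I'}$ to $J'_1=(\bigcup_{i\in I'}X_i,k',\mathrm{proj}_{I'}(\mathcal{R}'))$ satisfying $\sum_{j\in I'}\mathrm{cost}(X_j,\{\mathbf{c}_j\})\le(1+\alpha)\sum_{j\in I'}\mathrm{cost}(X_j,\{\mathbf{c}^*_j\})$, the pair $(C_1\cup C'_2,B)$ is $(5\delta+4\alpha)$-extendable for $J$.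
   Context: A tuple $(\mathbf{c}_1,\ldots,\mathbf{c}_k)$ of vectors in $\{0,1\}^m$ satisfies $\mathcal{R}=(R_1,\ldots,R_m)$, $R_i\subseteq\{0,1\}^k$, if $(\mathbf{c}_1[i],\ldots,\mathbf{c}_k[i])\in R_i$ for all $i$; a set of vectors satisfies a family of relations if some ordering of it does. For an instance $J=(X,k,\mathcal{R})$ of Binary Constrained Clustering, $\mathrm{cost}(A,Y)=\sum_{\mathbf{x}\in A}\min_{\mathbf{y}\in Y}d_H(\mathbf{x},\mathbf{y})$ ($d_H$ = Hamming distance), $\mathrm{OPT}(J)$ is the minimum of $\mathrm{cost}(X,C)$ over $C$ satisfying $\mathcal{R}$, and a solution is optimal if it attains it. Projection: for $I=\{i_1<\cdots<i_s\}$, $\mathrm{proj}_I(\mathcal{R})=(\{(t[i_1],\ldots,t[i_s]):t\in R_j\})_{j=1}^m$. Reduction: for ordered $C_1=(\mathbf{c}_1,\ldots,\mathbf{c}_s)$, $\mathcal{R}(I,C_1)=(R'_1,\ldots,R'_m)$ with $R'_j$ the set of tuples $(t[i])_{i\notin I}$ (increasing order) over $t\in R_j$ with $t[i_q]=\mathbf{c}_q[j]$ for all $q$. $\mathrm{OPT}_i(J)=\min\{\mathrm{OPT}(X,i,\mathrm{proj}_I(\mathcal{R})):|I|=i\}$; $J$ is $(j,\alpha)$-irreducible if $\mathrm{OPT}_{j-1}(J)\ge(1+\alpha)\mathrm{OPT}_j(J)$. For $B\subseteq X$ and a set $C_1$ of $k_1\le k$ vectors, $(C_1,B)$ is $\delta$-extendable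 for $J$ if there is a set $C_2$ of $k-k_1$ vectors with $C_1\cup C_2$ satisfying $\mathcal{R}$ and $\mathrm{cost}(B,C_1)+\mathrm{cost}(X\setminus B,C_1\cup C_2)\le(1+\delta)\mathrm{OPT}(J)$ ($C_2$ is a $\delta$-extension). A $\delta$-extension $C_2$ is good if there are a partition $Z_1\uplus Z_2=X\setminus B$ and $I\subseteq\{1,\ldots,k\}$, $|I|=|C_1|$, with $\mathrm{cost}(X\setminus B,C_1\cup C_2)=\mathrm{cost}(Z_1,C_1)+\mathrm{cost}(Z_2,C_2)$, $C_1$ (suitably ordered) satisfying $\mathrm{proj}_I(\mathcal{R})$, and $C_2$ an optimal solution of $(Z_2,k-|C_1|,\mathcal{R}(I,C_1))$, called the $C_2$-optimal reduced instance. The clusters corresponding to a solution $(\mathbf{c}_1,\ldots,\mathbf{c}_\ell)$ of an instance with vector set $Z$ form a partition $X_1\uplus\cdots\uplus X_\ell$ of $Z$ with total cost $\sum_j\sum_{\mathbf{x}\in X_j}d_H(\mathbf{x},\mathbf{c}_j)$ equal to the cost of the solution. For $\kappa>0$, a subset $\mathcal{X}$ of the clusters is a set of $\kappa$-heavy clusters if $|Y|>\kappa|W|$ for every $Y\in\mathcal{X}$ and every cluster $W\notin\mathcal{X}$.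
   Formalization: The parameters δ, α and δ' range over the rationals. -}

module Defs where

open import Data.Bool using (Bool; true; false; _∧_; if_then_else_)
open import Data.Nat as ℕ using (ℕ; zero; suc)
open import Data.Integer using (+_)
open import Data.Rational using (ℚ; _/_; 1ℚ; _+_; _*_; _≤_; _<_)
open import Data.Fin using (Fin; zero; suc; _≟_)
open import Data.Fin.Subset using (Subset; ∣_∣; ∁; _∩_; _∪_; _∈_; _∉_)
open import Data.Vec using (Vec; []; _∷_; [_]; lookup; map; tabulate; _++_)
open import Data.Product using (Σ; _×_)
open import Data.Unit using (⊤)
open import Data.Empty using (⊥)
open import Function.Bundles using (_↔_; Inverse)
open import Relation.Binary.PropositionalEquality using (_≡_)
open import Relation.Nullary using (does)

Pt : ℕ → Set
Pt m = Vec Bool m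

xor : Bool → Bool → Bool
xor true  b = if b then false else true
xor false b = b

dH : ∀ {m} → Pt m → Pt m → ℕ
dH []       []       = 0
dH (a ∷ u) (b ∷ v) = (if xor a b then 1 else 0) ℕ.+ dH u v

-- Extended naturals (costs; ∞ = minimum over an empty set of centres)

data ℕ∞ : Set where
  fin : ℕ → ℕ∞
  ∞   : ℕ∞

_⊕_ : ℕ∞ → ℕ∞ → ℕ∞
fin a ⊕ fin b = fin (a ℕ.+ b)
_     ⊕ _     = ∞

min∞ : ℕ∞ → ℕ∞ → ℕ∞
min∞ (fin a) (fin b) = fin (a ℕ.⊓ b)
min∞ (fin a) ∞       = fin a
min∞ ∞       b       = b

_≤∞_ : ℕ∞ → ℕ∞ → Set
fin a ≤∞ fin b = a ℕ.≤ b
fin a ≤∞ ∞     = ⊤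
∞     ≤∞ fin b = ⊥
∞     ≤∞ ∞     = ⊤

toℚ : ℕ → ℚ
toℚ n = + n / 1

ScaledLE : ℚ → ℕ∞ → ℚ → ℕ∞ → Set
ScaledLE p a       q ∞       = ⊤
ScaledLE p ∞       q (fin b) = ⊥
ScaledLE p (fin a) q (fin b) = p * toℚ a ≤ q * toℚ b

Σ∞ : ∀ {n} → (Fin n → ℕ∞) → ℕ∞
Σ∞ {zero}  f = fin 0
Σ∞ {suc n} f = f zero ⊕ Σ∞ (λ i → f (suc i))

minDist : ∀ {m ℓ} → Pt m → Vec (Pt m) ℓ → ℕ∞
minDist x []      = ∞
minDist x (y ∷ Y) = min∞ (fin (dH x y)) (minDist x Y)

-- cost(A, Y) where the point set X is indexed by Fin n and A ⊆ X is
-- given as a subset of indices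
cost : ∀ {m n ℓ} → Vec (Pt m) n → Subset n → Vec (Pt m) ℓ → ℕ∞
cost X A Y = Σ∞ (λ i → if lookup A i then minDist (lookup X i) Y else fin 0)

Rels : ℕ → ℕ → Set₁
Rels m k = Fin m → Vec Bool k → Set

Sat : ∀ {m k} → Rels m k → Vec (Pt m) k → Set
Sat R C = ∀ j → R j (map (λ c → lookup c j) C)

-- a (multi)set of vectors, listed as a tuple, satisfies R if some
-- ordering of it does (in particular it has exactly k elements)
SatSet : ∀ {m k k'} → Rels m k → Vec (Pt m) k' → Set
SatSet {k = k} {k'} R C =
  Σ (Fin k ↔ Fin k') λ σ → Sat R (tabulate (λ i → lookup C (Inverse.to σ i)))

pick : ∀ {A : Set} {k} (I : Subset k) → Vec A k → Vec A ∣ I ∣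
pick []          []      = []
pick (true ∷ I)  (a ∷ t) = a ∷ pick I t
pick (false ∷ I) (a ∷ t) = pick I t

proj : ∀ {m k} (I : Subset k) → Rels m k → Rels m ∣ I ∣
proj I R j u = Σ (Vec Bool _) λ t → R j t × pick I t ≡ u

reduce : ∀ {m k} (I : Subset k) → Vec (Pt m) ∣ I ∣ → Rels m k → Rels m ∣ ∁ I ∣
reduce I C₁ R j u =
  Σ (Vec Bool _) λ t → R j t × pick I t ≡ map (λ c → lookup c j) C₁
                     × pick (∁ I) t ≡ u

IsOPT : ∀ {m n k} → Vec (Pt m) n → Subset n → Rels m k → ℕ∞ → Set
IsOPT {m} X A R o =
  Σ ℕ (λ k' → Σ (Vec (Pt m) k') λ C → SatSet R C × cost X A C ≡ o)
  × (∀ {k'} (C : Vec (Pt m) k') → SatSet R C → o ≤∞ cost X A C)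

IsOptimal : ∀ {m n k k'} → Vec (Pt m) n → Subset n → Rels m k → Vec (Pt m) k' → Set
IsOptimal {m} X A R C =
  SatSet R C × (∀ {k''} (C' : Vec (Pt m) k'') → SatSet R C' → cost X A C ≤∞ cost X A C')

-- OPT_i(J) = o  (minimum over |I| = i of OPT(X, i, proj_I R); projections
-- without any solution have OPT = ∞ and do not affect the minimum)
IsOPTi : ∀ {m n k} → Vec (Pt m) n → Rels m k → ℕ → ℕ∞ → Set
IsOPTi {m} {n} {k} X R i o =
  Σ (Subset k) (λ I → ∣ I ∣ ≡ i × IsOPT X Data.Fin.Subset.⊤ (proj I R) o)
  × (∀ (I : Subset k) → ∣ I ∣ ≡ i → ∀ o' → IsOPT X Data.Fin.Subset.⊤ (proj I R) o' → o ≤∞ o')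

Irreducible : ∀ {m n k} → Vec (Pt m) n → Rels m k → ℕ → ℚ → Set
Irreducible X R j α =
  ∀ o' o → IsOPTi X R (j ℕ.∸ 1) o' → IsOPTi X R j o → ScaledLE (1ℚ + α) o 1ℚ o'

IsExtension : ∀ {m n k k₁ k₂} → ℚ → Vec (Pt m) n → Rels m k →
              Vec (Pt m) k₁ → Subset n → Vec (Pt m) k₂ → Set
IsExtension δ X R C₁ B C₂ =
  SatSet R (C₁ ++ C₂)
  × (∀ o → IsOPT X Data.Fin.Subset.⊤ R o →
       ScaledLE 1ℚ (cost X B C₁ ⊕ cost X (∁ B) (C₁ ++ C₂)) (1ℚ + δ) o)

Extendable : ∀ {m n k k₁} → ℚ → Vec (Pt m) n → Rels m k →
             Vec (Pt m) k₁ → Subset n → Set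
Extendable {m} δ X R C₁ B =
  Σ ℕ λ k₂ → Σ (Vec (Pt m) k₂) λ C₂ → IsExtension δ X R C₁ B C₂

reorder : ∀ {A : Set} {s k} → (Fin s ↔ Fin k) → Vec A k → Vec A s
reorder σ C = tabulate (λ q → lookup C (Inverse.to σ q))

-- C₂ is a good δ-extension of (C₁, B), witnessed by the partition
-- Z₁ ⊎ Z₂ = X ∖ B, the index set I with |I| = |C₁|, and the ordering σ of
-- C₁ (so that reorder σ C₁ satisfies proj_I(R)); then
-- (Z₂, |∁ I|, reduce I (reorder σ C₁) R) is the C₂-optimal reduced instance.
IsGoodExtensionBy : ∀ {m n k k₁} → ℚ → Vec (Pt m) n → Rels m k →
  (C₁ : Vec (Pt m) k₁) (B : Subset n) (I : Subset k) (σ : Fin ∣ I ∣ ↔ Fin k₁)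
  (C₂ : Vec (Pt m) ∣ ∁ I ∣) (Z₁ Z₂ : Subset n) → Set
IsGoodExtensionBy δ X R C₁ B I σ C₂ Z₁ Z₂ =
  IsExtension δ X R C₁ B C₂
  × Z₁ ∩ Z₂ ≡ Data.Fin.Subset.⊥
  × Z₁ ∪ Z₂ ≡ ∁ B
  × cost X (∁ B) (C₁ ++ C₂) ≡ (cost X Z₁ C₁ ⊕ cost X Z₂ C₂)
  × Sat (proj I R) (reorder σ C₁)
  × IsOptimal X Z₂ (reduce I (reorder σ C₁) R) C₂

cluster : ∀ {n ℓ} → Subset n → (Fin n → Fin ℓ) → Fin ℓ → Subset n
cluster Z asg j = tabulate (λ i → lookup Z i ∧ does (asg i ≟ j))

-- the assignment asg gives the clusters X_1 ⊎ … ⊎ X_ℓ = Z corresponding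
-- to the solution C = (c_1,…,c_ℓ): Σ_j cost(X_j, {c_j}) = cost(Z, C)
IsClusteringOf : ∀ {m n ℓ} → Vec (Pt m) n → Subset n → Vec (Pt m) ℓ →
                 (Fin n → Fin ℓ) → Set
IsClusteringOf X Z C asg =
  Σ∞ (λ j → cost X (cluster Z asg j) [ lookup C j ]) ≡ cost X Z C

IsHeavy : ∀ {n ℓ} → ℚ → (Fin ℓ → Subset n) → Subset ℓ → Set
IsHeavy κ Xc I' =
  ∀ y w → y ∈ I' → w ∉ I' → κ * toℚ ∣ Xc w ∣ < toℚ ∣ Xc y ∣

costOn : ∀ {m n ℓ} → Vec (Pt m) n → (Fin ℓ → Subset n) → Subset ℓ →
         Vec (Pt m) ℓ → ℕ∞
costOn X Xc I' C =
  Σ∞ (λ j → if lookup I' j then cost X (Xc j) [ lookup C j ] else fin 0)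

-- Repair C₂ coordinate by coordinate: wherever the heavy centres of C₂′ disagree with those of C₂,
-- replace that coordinate of all centres by a tuple of the reduced relation agreeing with C₂′ on the
-- heavy indices; it exists because C₂′ satisfies the projected relation. The repaired tuple E
-- satisfies the reduced relation, equals C₂′ on the heavy clusters, and moves every centre by at
-- most D = Σ_{heavy y} dH(C₂′ y, C₂ y). A light cluster is α/k times smaller than each heavy one and
-- there are at most k light clusters, so moving their centres costs at most α (cost(C₂′) + cost(C₂))
-- on the heavy clusters, which is at most 3α cost(C₂) there. Hence Z₂ costs at most (1 + 4α) times its
-- C₂-cost, and since C₂ is a δ-extension, (C₁ ∪ C₂′, B) is extendable with factor
-- (1 + 4α)(1 + δ) ≤ 1 + 5δ + 4α.

module Submission where

open import Defs
open import Data.Nat using (ℕ)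
open import Data.Fin using (Fin)
open import Data.Fin.Subset using (Subset; ∣_∣; ∁)
open import Data.Vec using (Vec; _++_)

module Rationals where
  open import Data.Nat as ℕ using (suc)
  import Data.Nat.Properties as ℕ
  open import Data.Integer as ℤ using (+_; +≤+)
  import Data.Integer.Properties as ℤ
  open import Data.Rational using (ℚ; mkℚ; 0ℚ; 1ℚ; _+_; _*_; _÷_; _≤_; _<_; ↥_; ↧ₙ_; 1/_; NonZero; >-nonZero;
                                   Positive; NonNegative; toℚᵘ; nonNegative; positive; *≤*)
  import Data.Rational.Properties as ℚ
  import Data.Rational.Unnormalised as ℚᵘ
  import Data.Rational.Unnormalised.Properties as ℚᵘ
  open import Data.Nat.Coprimality using (1-coprimeTo)
  import Data.Nat.Coprimality as Coprime
  open import Data.Rational.Solver using (module +-*-Solver)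
  open import Function.Bundles using (_⇔_; mk⇔)
  open import Relation.Binary.PropositionalEquality

  ⟦_⟧ᵘ : ℕ → ℚᵘ.ℚᵘ
  ⟦ n ⟧ᵘ = ℚᵘ.mkℚᵘ (+ n) 0

  toℚᵘ-toℚ : ∀ n → toℚᵘ (toℚ n) ≡ ⟦ n ⟧ᵘ
  toℚᵘ-toℚ n = cong toℚᵘ (ℚ.normalize-coprime {n} {0} (Coprime.sym (1-coprimeTo n)))

  ⟦⟧ᵘ-+ : ∀ a b → ⟦ a ⟧ᵘ ℚᵘ.+ ⟦ b ⟧ᵘ ℚᵘ.≃ ⟦ a ℕ.+ b ⟧ᵘ
  ⟦⟧ᵘ-+ a b = ℚᵘ.*≡* (begin
    (+ a ℤ.* + 1 ℤ.+ + b ℤ.* + 1) ℤ.* + 1 ≡⟨ ℤ.*-identityʳ _ ⟩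
    + a ℤ.* + 1 ℤ.+ + b ℤ.* + 1           ≡⟨ cong₂ ℤ._+_ (ℤ.*-identityʳ (+ a)) (ℤ.*-identityʳ (+ b)) ⟩
    + a ℤ.+ + b                           ≡⟨ ℤ.pos-+ a b ⟨
    + (a ℕ.+ b)                           ≡⟨ ℤ.*-identityʳ _ ⟨
    + (a ℕ.+ b) ℤ.* + 1                   ∎)
    where open ≡-Reasoning

  ⟦⟧ᵘ-* : ∀ a b → ⟦ a ⟧ᵘ ℚᵘ.* ⟦ b ⟧ᵘ ℚᵘ.≃ ⟦ a ℕ.* b ⟧ᵘ
  ⟦⟧ᵘ-* a b = ℚᵘ.*≡* (begin
    (+ a ℤ.* + b) ℤ.* + 1 ≡⟨ ℤ.*-identityʳ _ ⟩
    + a ℤ.* + b           ≡⟨ ℤ.pos-* a b ⟨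
    + (a ℕ.* b)           ≡⟨ ℤ.*-identityʳ _ ⟨
    + (a ℕ.* b) ℤ.* + 1   ∎)
    where open ≡-Reasoning

  toℚ-+ : ∀ a b → toℚ (a ℕ.+ b) ≡ toℚ a + toℚ b
  toℚ-+ a b = ℚ.toℚᵘ-injective (begin
    toℚᵘ (toℚ (a ℕ.+ b))          ≡⟨ toℚᵘ-toℚ (a ℕ.+ b) ⟩
    ⟦ a ℕ.+ b ⟧ᵘ                  ≈⟨ ⟦⟧ᵘ-+ a b ⟨
    ⟦ a ⟧ᵘ ℚᵘ.+ ⟦ b ⟧ᵘ            ≡⟨ cong₂ ℚᵘ._+_ (toℚᵘ-toℚ a) (toℚᵘ-toℚ b) ⟨
    toℚᵘ (toℚ a) ℚᵘ.+ toℚᵘ (toℚ b) ≈⟨ ℚ.toℚᵘ-homo-+ (toℚ a) (toℚ b) ⟨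
    toℚᵘ (toℚ a + toℚ b)          ∎)
    where open ℚᵘ.≃-Reasoning

  toℚ-* : ∀ a b → toℚ (a ℕ.* b) ≡ toℚ a * toℚ b
  toℚ-* a b = ℚ.toℚᵘ-injective (begin
    toℚᵘ (toℚ (a ℕ.* b))          ≡⟨ toℚᵘ-toℚ (a ℕ.* b) ⟩
    ⟦ a ℕ.* b ⟧ᵘ                  ≈⟨ ⟦⟧ᵘ-* a b ⟨
    ⟦ a ⟧ᵘ ℚᵘ.* ⟦ b ⟧ᵘ            ≡⟨ cong₂ ℚᵘ._*_ (toℚᵘ-toℚ a) (toℚᵘ-toℚ b) ⟨
    toℚᵘ (toℚ a) ℚᵘ.* toℚᵘ (toℚ b) ≈⟨ ℚ.toℚᵘ-homo-* (toℚ a) (toℚ b) ⟨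
    toℚᵘ (toℚ a * toℚ b)          ∎)
    where open ℚᵘ.≃-Reasoning

  toℚ-mono-≤ : ∀ {a b} → a ℕ.≤ b → toℚ a ≤ toℚ b
  toℚ-mono-≤ {a} {b} a≤b = ℚ.toℚᵘ-cancel-≤ (subst₂ ℚᵘ._≤_ (sym (toℚᵘ-toℚ a)) (sym (toℚᵘ-toℚ b))
    (ℚᵘ.*≤* (subst₂ ℤ._≤_ (sym (ℤ.*-identityʳ (+ a))) (sym (ℤ.*-identityʳ (+ b))) (+≤+ a≤b))))

  toℚ-cancel-≤ : ∀ {a b} → toℚ a ≤ toℚ b → a ℕ.≤ b
  toℚ-cancel-≤ {a} {b} a≤b with subst₂ ℚᵘ._≤_ (toℚᵘ-toℚ a) (toℚᵘ-toℚ b) (ℚ.toℚᵘ-mono-≤ a≤b)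
  ... | ℚᵘ.*≤* a*1≤b*1 with subst₂ ℤ._≤_ (ℤ.*-identityʳ (+ a)) (ℤ.*-identityʳ (+ b)) a*1≤b*1
  ...   | +≤+ a≤b′ = a≤b′

  toℚ-nonNeg : ∀ n → NonNegative (toℚ n)
  toℚ-nonNeg n = ℚ.normalize-nonNeg n 1

  -- α = num α / den α only when 0 ≤ α: num drops the sign of the numerator.
  num den : ℚ → ℕ
  num α = ℤ.∣ ↥ α ∣
  den α = ↧ₙ α

  den-*-≡-num : ∀ α → 0ℚ ≤ α → toℚ (den α) * α ≡ toℚ (num α)
  den-*-≡-num (mkℚ (+ p) d c) _ = ℚ.toℚᵘ-injective (begin
    toℚᵘ (toℚ (suc d) * mkℚ (+ p) d c)      ≈⟨ ℚ.toℚᵘ-homo-* (toℚ (suc d)) (mkℚ (+ p) d c) ⟩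
    toℚᵘ (toℚ (suc d)) ℚᵘ.* ℚᵘ.mkℚᵘ (+ p) d ≡⟨ cong (ℚᵘ._* ℚᵘ.mkℚᵘ (+ p) d) (toℚᵘ-toℚ (suc d)) ⟩
    ⟦ suc d ⟧ᵘ ℚᵘ.* ℚᵘ.mkℚᵘ (+ p) d         ≈⟨ ℚᵘ.*≡* cross ⟩
    ⟦ p ⟧ᵘ                                  ≡⟨ toℚᵘ-toℚ p ⟨
    toℚᵘ (toℚ p)                            ∎)
    where
    open ℚᵘ.≃-Reasoning
    cross : (+ suc d ℤ.* + p) ℤ.* + 1 ≡ + p ℤ.* + (1 ℕ.* suc d)
    cross = trans (ℤ.*-identityʳ _) (trans (ℤ.*-comm (+ suc d) (+ p))
                  (cong (λ z → + p ℤ.* + z) (sym (ℕ.*-identityˡ (suc d)))))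
  den-*-≡-num (mkℚ ℤ.-[1+ _ ] _ _) (*≤* ())

  den-nonZero : ∀ α → ℕ.NonZero (den α)
  den-nonZero (mkℚ _ _ _) = _

  den-pos : ∀ α → Positive (toℚ (den α))
  den-pos (mkℚ _ d _) = ℚ.normalize-pos (suc d) 1

  num≤den : ∀ {α} → 0ℚ ≤ α → α ≤ 1ℚ → num α ℕ.≤ den α
  num≤den {α} 0≤α α≤1 = toℚ-cancel-≤ (begin
    toℚ (num α)       ≡⟨ den-*-≡-num α 0≤α ⟨
    toℚ (den α) * α   ≤⟨ ℚ.*-monoˡ-≤-nonNeg (toℚ (den α)) {{toℚ-nonNeg (den α)}} α≤1 ⟩
    toℚ (den α) * 1ℚ  ≡⟨ ℚ.*-identityʳ _ ⟩
    toℚ (den α)       ∎)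
    where open ℚ.≤-Reasoning

  module _ {α : ℚ} (0≤α : 0ℚ ≤ α) where
    open +-*-Solver

    private
      D : ℚ
      D = toℚ (den α)
      instance
        D-pos : Positive D
        D-pos = den-pos α
        D-nonNeg : NonNegative D
        D-nonNeg = toℚ-nonNeg (den α)

    toℚ-cleared : ∀ c b → toℚ ((den α ℕ.+ c ℕ.* num α) ℕ.* b) ≡ D * ((1ℚ + toℚ c * α) * toℚ b)
    toℚ-cleared c b = begin
      toℚ ((den α ℕ.+ c ℕ.* num α) ℕ.* b)
        ≡⟨ toℚ-* (den α ℕ.+ c ℕ.* num α) b ⟩
      toℚ (den α ℕ.+ c ℕ.* num α) * toℚ b
        ≡⟨ cong (_* toℚ b) (trans (toℚ-+ (den α) (c ℕ.* num α)) (cong (λ z → D + z) (toℚ-* c (num α)))) ⟩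
      (D + toℚ c * toℚ (num α)) * toℚ b
        ≡⟨ cong (λ z → (D + toℚ c * z) * toℚ b) (den-*-≡-num α 0≤α) ⟨
      (D + toℚ c * (D * α)) * toℚ b
        ≡⟨ solve 4 (λ d c a b → (d :+ c :* (d :* a)) :* b := d :* ((con 1ℚ :+ c :* a) :* b)) refl D (toℚ c) α (toℚ b) ⟩
      D * ((1ℚ + toℚ c * α) * toℚ b) ∎
      where open ≡-Reasoning

    ≤-cleared : ∀ c a b → toℚ a ≤ (1ℚ + toℚ c * α) * toℚ b ⇔ den α ℕ.* a ℕ.≤ (den α ℕ.+ c ℕ.* num α) ℕ.* b
    ≤-cleared c a b = mk⇔
      (λ a≤ → toℚ-cancel-≤ (subst₂ _≤_ (sym (toℚ-* (den α) a)) (sym (toℚ-cleared c b)) (ℚ.*-monoˡ-≤-nonNeg D a≤)))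
      (λ a≤ → ℚ.*-cancelˡ-≤-pos D (subst₂ _≤_ (toℚ-* (den α) a) (toℚ-cleared c b) (toℚ-mono-≤ a≤)))

    ≤-approx-trans : ∀ {δ x y z} c → α ≤ 1ℚ → 0ℚ ≤ δ → 0ℚ ≤ z →
                     x ≤ (1ℚ + toℚ c * α) * y → y ≤ (1ℚ + δ) * z →
                     x ≤ (1ℚ + ((1ℚ + toℚ c) * δ + toℚ c * α)) * z
    ≤-approx-trans {δ} {x} {y} {z} c α≤1 0≤δ 0≤z x≤ y≤ = begin
      x                                          ≤⟨ x≤ ⟩
      (1ℚ + C * α) * y                           ≤⟨ ℚ.*-monoˡ-≤-nonNeg (1ℚ + C * α) y≤ ⟩
      (1ℚ + C * α) * ((1ℚ + δ) * z)              ≡⟨ solve 4 (λ a d z c → (con 1ℚ :+ c :* a) :* ((con 1ℚ :+ d) :* z)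
                                                       := (con 1ℚ :+ c :* a :+ d) :* z :+ c :* ((a :* d) :* z)) refl α δ z C ⟩
      (1ℚ + C * α + δ) * z + C * ((α * δ) * z)   ≤⟨ ℚ.+-monoʳ-≤ ((1ℚ + C * α + δ) * z)
                                                      (ℚ.*-monoˡ-≤-nonNeg C (ℚ.*-monoʳ-≤-nonNeg z αδ≤δ)) ⟩
      (1ℚ + C * α + δ) * z + C * (δ * z)         ≡⟨ solve 4 (λ a d z c → (con 1ℚ :+ c :* a :+ d) :* z :+ c :* (d :* z)
                                                       := (con 1ℚ :+ ((con 1ℚ :+ c) :* d :+ c :* a)) :* z) refl α δ z C ⟩
      (1ℚ + ((1ℚ + C) * δ + C * α)) * z          ∎
      where
      open ℚ.≤-Reasoning
      C : ℚ
      C = toℚ c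
      instance
        C-nonNeg : NonNegative C
        C-nonNeg = toℚ-nonNeg c
        α-nonNeg : NonNegative α
        α-nonNeg = nonNegative 0≤α
        δ-nonNeg : NonNegative δ
        δ-nonNeg = nonNegative 0≤δ
        z-nonNeg : NonNegative z
        z-nonNeg = nonNegative 0≤z
        1+Cα-nonNeg : NonNegative (1ℚ + C * α)
        1+Cα-nonNeg = ℚ.nonNeg+nonNeg⇒nonNeg 1ℚ (C * α) {{ℚ.nonNeg*nonNeg⇒nonNeg C α}}
      αδ≤δ : α * δ ≤ δ
      αδ≤δ = subst (α * δ ≤_) (ℚ.*-identityˡ δ) (ℚ.*-monoʳ-≤-nonNeg δ α≤1)

  <-÷-cleared : ∀ {α} (0<α : 0ℚ < α) k w y → ((toℚ k ÷ α) {{>-nonZero 0<α}}) * toℚ w < toℚ y →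
                den α ℕ.* (k ℕ.* w) ℕ.≤ num α ℕ.* y
  <-÷-cleared {α} 0<α k w y k/α*w<y = toℚ-cancel-≤ (begin
    toℚ (den α ℕ.* (k ℕ.* w))  ≡⟨ trans (toℚ-* (den α) (k ℕ.* w)) (cong (D *_) (toℚ-* k w)) ⟩
    D * (K * W)                ≤⟨ ℚ.*-monoˡ-≤-nonNeg D {{toℚ-nonNeg (den α)}} KW≤αY ⟩
    D * (α * Y)                ≡⟨ ℚ.*-assoc D α Y ⟨
    D * α * Y                  ≡⟨ cong (_* Y) (den-*-≡-num α (ℚ.<⇒≤ 0<α)) ⟩
    toℚ (num α) * Y            ≡⟨ toℚ-* (num α) y ⟨
    toℚ (num α ℕ.* y)          ∎)
    where
    open ℚ.≤-Reasoning
    open +-*-Solver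
    instance
      α-nonZero : NonZero α
      α-nonZero = >-nonZero 0<α
    D K W Y : ℚ
    D = toℚ (den α)
    K = toℚ k
    W = toℚ w
    Y = toℚ y
    α*k/α*w≡kw : α * ((K * 1/ α) * W) ≡ K * W
    α*k/α*w≡kw = begin-equality
      α * ((K * 1/ α) * W)   ≡⟨ solve 4 (λ a k b w → a :* ((k :* b) :* w) := (k :* w) :* (a :* b)) refl α K (1/ α) W ⟩
      (K * W) * (α * 1/ α)   ≡⟨ cong ((K * W) *_) (ℚ.*-inverseʳ α) ⟩
      (K * W) * 1ℚ           ≡⟨ ℚ.*-identityʳ (K * W) ⟩
      K * W                  ∎
    KW≤αY : K * W ≤ α * Y
    KW≤αY = ℚ.<⇒≤ (subst (_< α * Y) α*k/α*w≡kw (ℚ.*-monoʳ-<-pos α {{positive 0<α}} k/α*w<y))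

module Sums where
  open import Data.Bool using (true; false; _∧_; if_then_else_)
  open import Data.Nat using (zero; suc; _+_; _*_; _≤_; z≤n)
  open import Data.Nat.Properties hiding (_≟_)
  open import Data.Fin using (zero; suc; _≟_)
  open import Function using (_∘_)
  open import Algebra.Properties.CommutativeSemigroup +-commutativeSemigroup using (x∙yz≈y∙xz; interchange)
  open import Data.Vec using ([]; _∷_; lookup)
  open import Data.Vec.Properties using (lookup∘tabulate)
  open import Relation.Nullary using (does; yes; no)
  open import Relation.Binary.PropositionalEquality
  open import Algebra.Properties.Semiring.Sum +-*-semiring public
    using (sum; sum-cong-≗; ∑-comm; sum-replicate-zero)

  sumOver : ∀ {n} → Subset n → (Fin n → ℕ) → ℕ
  sumOver A f = sum (λ i → if lookup A i then f i else 0)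

  sum-mono-≤ : ∀ {n} {f g : Fin n → ℕ} → (∀ i → f i ≤ g i) → sum f ≤ sum g
  sum-mono-≤ {zero}  f≤g = z≤n
  sum-mono-≤ {suc n} f≤g = +-mono-≤ (f≤g zero) (sum-mono-≤ (f≤g ∘ suc))

  sum-indicator : ∀ {n} (a : Fin n) (f : Fin n → ℕ) → sum (λ j → if does (a ≟ j) then f j else 0) ≡ f a
  sum-indicator {suc n} zero f = trans (cong (f zero +_) (sum-replicate-zero n)) (+-identityʳ (f zero))
  sum-indicator (suc a) f   = trans (sum-cong-≗ shift) (sum-indicator a (λ j → f (suc j)))
    where
    shift : ∀ j → (if does (suc a ≟ suc j) then f (suc j) else 0) ≡ (if does (a ≟ j) then f (suc j) else 0)
    shift j with a ≟ j
    ... | yes _ = refl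
    ... | no _  = refl

  sumOver-mono-≤ : ∀ {n} (A : Subset n) {f g : Fin n → ℕ} →
                   (∀ i → lookup A i ≡ true → f i ≤ g i) → sumOver A f ≤ sumOver A g
  sumOver-mono-≤ A {f} {g} f≤g = sum-mono-≤ pointwise
    where
    pointwise : ∀ i → (if lookup A i then f i else 0) ≤ (if lookup A i then g i else 0)
    pointwise i with lookup A i in i∈A
    ... | true  = f≤g i i∈A
    ... | false = z≤n

  ≤-sumOver : ∀ {n} (A : Subset n) (f : Fin n → ℕ) i → lookup A i ≡ true → f i ≤ sumOver A f
  ≤-sumOver (true ∷ A)  f zero    _   = m≤m+n (f zero) _
  ≤-sumOver (b ∷ A)     f (suc i) i∈A = ≤-trans (≤-sumOver A (λ j → f (suc j)) i i∈A) (m≤n+m _ _)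

  sumOver-split : ∀ {n} (A : Subset n) (f : Fin n → ℕ) → sum f ≡ sumOver A f + sumOver (∁ A) f
  sumOver-split []          f = refl
  sumOver-split (true ∷ A)  f = trans (cong (f zero +_) (sumOver-split A (f ∘ suc)))
                                      (sym (+-assoc (f zero) (sumOver A (f ∘ suc)) (sumOver (∁ A) (f ∘ suc))))
  sumOver-split (false ∷ A) f = trans (cong (f zero +_) (sumOver-split A (f ∘ suc)))
                                      (x∙yz≈y∙xz (f zero) (sumOver A (f ∘ suc)) (sumOver (∁ A) (f ∘ suc)))

  sumOver-+ : ∀ {n} (A : Subset n) (f g : Fin n → ℕ) →
              sumOver A (λ i → f i + g i) ≡ sumOver A f + sumOver A g
  sumOver-+ []          f g = refl
  sumOver-+ (true ∷ A)  f g = trans (cong (f zero + g zero +_) (sumOver-+ A (f ∘ suc) (g ∘ suc)))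
                                    (interchange (f zero) (g zero) (sumOver A (f ∘ suc)) (sumOver A (g ∘ suc)))
  sumOver-+ (false ∷ A) f g = sumOver-+ A (f ∘ suc) (g ∘ suc)

  *-distribˡ-sumOver : ∀ {n} c (A : Subset n) (f : Fin n → ℕ) →
                       c * sumOver A f ≡ sumOver A (λ i → c * f i)
  *-distribˡ-sumOver c []          f = *-zeroʳ c
  *-distribˡ-sumOver c (true ∷ A)  f = trans (*-distribˡ-+ c (f zero) (sumOver A (f ∘ suc)))
                                             (cong (c * f zero +_) (*-distribˡ-sumOver c A (f ∘ suc)))
  *-distribˡ-sumOver c (false ∷ A) f = *-distribˡ-sumOver c A (f ∘ suc)

  sumOver-const : ∀ {n} (A : Subset n) c → sumOver A (λ _ → c) ≡ ∣ A ∣ * c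
  sumOver-const []          c = refl
  sumOver-const (true ∷ A)  c = cong (c +_) (sumOver-const A c)
  sumOver-const (false ∷ A) c = sumOver-const A c

  sum-sumOver-comm : ∀ {n p} (A : Subset n) (f : Fin n → Fin p → ℕ) →
                     sum (λ c → sumOver A (λ y → f y c)) ≡ sumOver A (λ y → sum (f y))
  sum-sumOver-comm {p = p} A f = trans (∑-comm (λ c y → if lookup A y then f y c else 0)) (sum-cong-≗ inner)
    where
    inner : ∀ y → sum (λ c → if lookup A y then f y c else 0) ≡ (if lookup A y then sum (f y) else 0)
    inner y with lookup A y
    ... | true  = refl
    ... | false = sum-replicate-zero p

  sumOver-cluster : ∀ {n ℓ} (Z : Subset n) (asg : Fin n → Fin ℓ) (f : Fin ℓ → Fin n → ℕ) →
                    sum (λ j → sumOver (cluster Z asg j) (f j)) ≡ sumOver Z (λ i → f (asg i) i)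
  sumOver-cluster {ℓ = ℓ} Z asg f = begin
    sum (λ j → sumOver (cluster Z asg j) (f j))
      ≡⟨ sum-cong-≗ (λ j → sum-cong-≗ (λ i → cong (λ b → if b then f j i else 0) (lookup∘tabulate _ i))) ⟩
    sum (λ j → sum (λ i → if lookup Z i ∧ does (asg i ≟ j) then f j i else 0))
      ≡⟨ ∑-comm (λ j i → if lookup Z i ∧ does (asg i ≟ j) then f j i else 0) ⟩
    sum (λ i → sum (λ j → if lookup Z i ∧ does (asg i ≟ j) then f j i else 0))
      ≡⟨ sum-cong-≗ assigned ⟩
    sumOver Z (λ i → f (asg i) i)  ∎
    where
    open ≡-Reasoning
    assigned : ∀ i → sum (λ j → if lookup Z i ∧ does (asg i ≟ j) then f j i else 0)
                     ≡ (if lookup Z i then f (asg i) i else 0)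
    assigned i with lookup Z i
    ... | true  = sum-indicator (asg i) (λ j → f j i)
    ... | false = sum-replicate-zero ℓ

module Costs where
  open import Data.Bool using (Bool; true; false; _∨_; if_then_else_)
  open import Data.Nat using (zero; suc; _+_; _*_; _≤_; z≤n)
  open import Data.Nat.Properties hiding (_≟_)
  open import Data.Fin using (zero; suc)
  open import Data.Fin.Subset using (_∪_)
  open import Data.Vec using ([]; _∷_; [_]; lookup)
  open import Data.Vec.Properties using (lookup-zipWith)
  open import Data.Vec.Membership.Propositional using () renaming (_∈_ to _∈ᵥ_)
  open import Data.Vec.Relation.Unary.Any using (here; there)
  open import Data.Unit using (tt)
  open import Function using (_∘_)
  open import Algebra.Properties.CommutativeSemigroup +-commutativeSemigroup using (interchange)
  open import Relation.Binary.PropositionalEquality hiding ([_])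
  open Sums

  ≤∞-refl : ∀ a → a ≤∞ a
  ≤∞-refl (fin a) = ≤-refl
  ≤∞-refl ∞       = tt

  ≤∞-trans : ∀ {a b c} → a ≤∞ b → b ≤∞ c → a ≤∞ c
  ≤∞-trans {fin a} {fin b} {fin c} a≤b b≤c = ≤-trans a≤b b≤c
  ≤∞-trans {fin a} {fin b} {∞}     _   _   = tt
  ≤∞-trans {fin a} {∞}     {∞}     _   _   = tt
  ≤∞-trans {∞}     {∞}     {∞}     _   _   = tt

  ≤∞-∞ : ∀ a → a ≤∞ ∞
  ≤∞-∞ (fin a) = tt
  ≤∞-∞ ∞       = tt

  ≤∞-⊕ : ∀ a d → a ≤∞ (a ⊕ fin d)
  ≤∞-⊕ (fin a) d = m≤m+n a d
  ≤∞-⊕ ∞       d = tt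

  ⊕-mono-≤∞ : ∀ {a b c d} → a ≤∞ b → c ≤∞ d → (a ⊕ c) ≤∞ (b ⊕ d)
  ⊕-mono-≤∞ {fin a} {fin b} {fin c} {fin d} a≤b c≤d = +-mono-≤ a≤b c≤d
  ⊕-mono-≤∞ {fin a} {fin b} {fin c} {∞}     _   _   = tt
  ⊕-mono-≤∞ {fin a} {fin b} {∞}     {∞}     _   _   = tt
  ⊕-mono-≤∞ {fin a} {∞}     {c}     {d}     _   _   = ≤∞-∞ (fin a ⊕ c)
  ⊕-mono-≤∞ {∞}     {∞}     {c}     {d}     _   _   = tt

  Σ∞-mono-≤∞ : ∀ {n} {f g : Fin n → ℕ∞} → (∀ i → f i ≤∞ g i) → Σ∞ f ≤∞ Σ∞ g
  Σ∞-mono-≤∞ {zero}  f≤g = ≤-refl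
  Σ∞-mono-≤∞ {suc n} f≤g = ⊕-mono-≤∞ (f≤g zero) (Σ∞-mono-≤∞ (f≤g ∘ suc))

  Σ∞-fin : ∀ {n} {f : Fin n → ℕ∞} (g : Fin n → ℕ) → (∀ i → f i ≡ fin (g i)) → Σ∞ f ≡ fin (sum g)
  Σ∞-fin {zero}  g f≡g = refl
  Σ∞-fin {suc n} g f≡g rewrite f≡g zero | Σ∞-fin (g ∘ suc) (f≡g ∘ suc) = refl

  Σ∞-⊕-fin : ∀ {n} (a : Fin n → ℕ∞) (g : Fin n → ℕ) → Σ∞ (λ i → a i ⊕ fin (g i)) ≤∞ (Σ∞ a ⊕ fin (sum g))
  Σ∞-⊕-fin {zero}  a g = ≤-refl
  Σ∞-⊕-fin {suc n} a g = ≤∞-trans (⊕-mono-≤∞ (≤∞-refl (a zero ⊕ fin (g zero))) (Σ∞-⊕-fin (a ∘ suc) (g ∘ suc)))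
                                  (reassociate (a zero) (Σ∞ (a ∘ suc)))
    where
    reassociate : ∀ x y → ((x ⊕ fin (g zero)) ⊕ (y ⊕ fin (sum (g ∘ suc)))) ≤∞ ((x ⊕ y) ⊕ fin (sum g))
    reassociate (fin x) (fin y) = ≤-reflexive (interchange x (g zero) y (sum (g ∘ suc)))
    reassociate (fin x) ∞       = tt
    reassociate ∞       y       = tt

  bitDiff : Bool → Bool → ℕ
  bitDiff a b = if xor a b then 1 else 0

  bitDiff-sym : ∀ a b → bitDiff a b ≡ bitDiff b a
  bitDiff-sym true  true  = refl
  bitDiff-sym true  false = refl
  bitDiff-sym false true  = refl
  bitDiff-sym false false = refl

  bitDiff-triangle : ∀ a b c → bitDiff a c ≤ bitDiff a b + bitDiff b c
  bitDiff-triangle true  true  c     = ≤-refl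
  bitDiff-triangle false false c     = ≤-refl
  bitDiff-triangle true  false true  = z≤n
  bitDiff-triangle true  false false = ≤-refl
  bitDiff-triangle false true  true  = ≤-refl
  bitDiff-triangle false true  false = z≤n

  bitDiff-≤1 : ∀ a b → bitDiff a b ≤ 1
  bitDiff-≤1 true  true  = z≤n
  bitDiff-≤1 true  false = ≤-refl
  bitDiff-≤1 false true  = ≤-refl
  bitDiff-≤1 false false = z≤n

  bitDiff-self : ∀ a → bitDiff a a ≡ 0
  bitDiff-self true  = refl
  bitDiff-self false = refl

  bitDiff≡0⇒≡ : ∀ {a b} → bitDiff a b ≤ 0 → a ≡ b
  bitDiff≡0⇒≡ {true}  {true}  _ = refl
  bitDiff≡0⇒≡ {false} {false} _ = refl

  dH-sum : ∀ {m} (u v : Pt m) → dH u v ≡ sum (λ c → bitDiff (lookup u c) (lookup v c))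
  dH-sum []      []      = refl
  dH-sum (a ∷ u) (b ∷ v) = cong (bitDiff a b +_) (dH-sum u v)

  dH-sym : ∀ {m} (u v : Pt m) → dH u v ≡ dH v u
  dH-sym []      []      = refl
  dH-sym (a ∷ u) (b ∷ v) = cong₂ _+_ (bitDiff-sym a b) (dH-sym u v)

  dH-triangle : ∀ {m} (x y z : Pt m) → dH x z ≤ dH x y + dH y z
  dH-triangle []      []      []      = z≤n
  dH-triangle (a ∷ x) (b ∷ y) (c ∷ z) =
    ≤-trans (+-mono-≤ (bitDiff-triangle a b c) (dH-triangle x y z))
            (≤-reflexive (interchange (bitDiff a b) (bitDiff b c) (dH x y) (dH y z)))

  min∞-≤ˡ : ∀ a b → min∞ (fin a) b ≤∞ fin a
  min∞-≤ˡ a (fin b) = m⊓n≤m a b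
  min∞-≤ˡ a ∞       = ≤-refl

  min∞-≤ʳ : ∀ a b → min∞ (fin a) b ≤∞ b
  min∞-≤ʳ a (fin b) = m⊓n≤n a b
  min∞-≤ʳ a ∞       = tt

  min∞-monoʳ-≤∞ : ∀ a {b c} → b ≤∞ c → min∞ (fin a) b ≤∞ min∞ (fin a) c
  min∞-monoʳ-≤∞ a {fin b} {fin c} b≤c = ⊓-monoʳ-≤ a b≤c
  min∞-monoʳ-≤∞ a {fin b} {∞}     _   = m⊓n≤m a b
  min∞-monoʳ-≤∞ a {∞}     {∞}     _   = ≤-refl

  minDist-≤-∈ : ∀ {m ℓ} (x : Pt m) {y} {Y : Vec (Pt m) ℓ} → y ∈ᵥ Y → minDist x Y ≤∞ fin (dH x y)
  minDist-≤-∈ x {Y = y ∷ Y} (here refl) = min∞-≤ˡ (dH x y) (minDist x Y)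
  minDist-≤-∈ x {Y = c ∷ Y} (there y∈Y) =
    ≤∞-trans (min∞-≤ʳ (dH x c) (minDist x Y)) (minDist-≤-∈ x y∈Y)

  minDist-++ˡ : ∀ {m k l} (x : Pt m) (C : Vec (Pt m) k) (D : Vec (Pt m) l) → minDist x (C ++ D) ≤∞ minDist x C
  minDist-++ˡ x []      D = ≤∞-∞ (minDist x D)
  minDist-++ˡ x (c ∷ C) D = min∞-monoʳ-≤∞ (dH x c) (minDist-++ˡ x C D)

  centreCost : ∀ {m n} → Vec (Pt m) n → Subset n → Pt m → ℕ
  centreCost X A c = sumOver A (λ i → dH (lookup X i) c)

  cost-[] : ∀ {m n} (X : Vec (Pt m) n) A c → cost X A [ c ] ≡ fin (centreCost X A c)
  cost-[] X A c = Σ∞-fin _ pointwise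
    where
    pointwise : ∀ i → (if lookup A i then minDist (lookup X i) [ c ] else fin 0)
                      ≡ fin (if lookup A i then dH (lookup X i) c else 0)
    pointwise i with lookup A i
    ... | true  = refl
    ... | false = refl

  centreCost-shift : ∀ {m n} (X : Vec (Pt m) n) A c e → centreCost X A e ≤ centreCost X A c + ∣ A ∣ * dH c e
  centreCost-shift X A c e = begin
    centreCost X A e                                       ≤⟨ sumOver-mono-≤ A (λ i _ → dH-triangle (lookup X i) c e) ⟩
    sumOver A (λ i → dH (lookup X i) c + dH c e)           ≡⟨ sumOver-+ A (λ i → dH (lookup X i) c) (λ _ → dH c e) ⟩
    centreCost X A c + sumOver A (λ _ → dH c e)            ≡⟨ cong (centreCost X A c +_) (sumOver-const A (dH c e)) ⟩
    centreCost X A c + ∣ A ∣ * dH c e                      ∎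
    where open ≤-Reasoning

  centreCost-pair : ∀ {m n} (X : Vec (Pt m) n) A a b → ∣ A ∣ * dH a b ≤ centreCost X A a + centreCost X A b
  centreCost-pair X A a b = begin
    ∣ A ∣ * dH a b                                         ≡⟨ sumOver-const A (dH a b) ⟨
    sumOver A (λ _ → dH a b)                               ≤⟨ sumOver-mono-≤ A via ⟩
    sumOver A (λ i → dH (lookup X i) a + dH (lookup X i) b) ≡⟨ sumOver-+ A (λ i → dH (lookup X i) a) (λ i → dH (lookup X i) b) ⟩
    centreCost X A a + centreCost X A b                    ∎
    where
    open ≤-Reasoning
    via : ∀ i → lookup A i ≡ true → dH a b ≤ dH (lookup X i) a + dH (lookup X i) b
    via i _ = ≤-trans (dH-triangle a (lookup X i) b) (+-monoˡ-≤ _ (≤-reflexive (dH-sym a (lookup X i))))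

  cost-++ˡ : ∀ {m n k l} (X : Vec (Pt m) n) B (C : Vec (Pt m) k) (D : Vec (Pt m) l) →
             cost X B (C ++ D) ≤∞ cost X B C
  cost-++ˡ X B C D = Σ∞-mono-≤∞ pointwise
    where
    pointwise : ∀ i → (if lookup B i then minDist (lookup X i) (C ++ D) else fin 0)
                      ≤∞ (if lookup B i then minDist (lookup X i) C else fin 0)
    pointwise i with lookup B i
    ... | true  = minDist-++ˡ (lookup X i) C D
    ... | false = ≤-refl

  cost-∪-≤ : ∀ {m n k ℓ} (X : Vec (Pt m) n) (Z₁ Z₂ : Subset n) (asg : Fin n → Fin ℓ) (V : Vec (Pt m) k)
             (E : Vec (Pt m) ℓ) → (∀ j → lookup E j ∈ᵥ V) →
             cost X (Z₁ ∪ Z₂) V ≤∞ (cost X Z₁ V ⊕ fin (sum (λ j → centreCost X (cluster Z₂ asg j) (lookup E j))))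
  cost-∪-≤ X Z₁ Z₂ asg V E E∈V =
    subst (λ s → cost X (Z₁ ∪ Z₂) V ≤∞ (cost X Z₁ V ⊕ fin s))
          (sym (sumOver-cluster Z₂ asg (λ j i → dH (lookup X i) (lookup E j))))
          (≤∞-trans (Σ∞-mono-≤∞ pointwise)
                    (Σ∞-⊕-fin (λ i → if lookup Z₁ i then minDist (lookup X i) V else fin 0)
                              (λ i → if lookup Z₂ i then dH (lookup X i) (lookup E (asg i)) else 0)))
    where
    pointwise : ∀ i → (if lookup (Z₁ ∪ Z₂) i then minDist (lookup X i) V else fin 0)
                      ≤∞ ((if lookup Z₁ i then minDist (lookup X i) V else fin 0)
                          ⊕ fin (if lookup Z₂ i then dH (lookup X i) (lookup E (asg i)) else 0))
    pointwise i rewrite lookup-zipWith _∨_ i Z₁ Z₂ with lookup Z₁ i | lookup Z₂ i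
    ... | true  | _     = ≤∞-⊕ (minDist (lookup X i) V) _
    ... | false | true  = minDist-≤-∈ (lookup X i) (E∈V (asg i))
    ... | false | false = z≤n

  costOn-fin : ∀ {m n ℓ} (X : Vec (Pt m) n) (Xc : Fin ℓ → Subset n) I′ (C : Vec (Pt m) ℓ) →
               costOn X Xc I′ C ≡ fin (sumOver I′ (λ j → centreCost X (Xc j) (lookup C j)))
  costOn-fin X Xc I′ C = Σ∞-fin _ pointwise
    where
    pointwise : ∀ j → (if lookup I′ j then cost X (Xc j) [ lookup C j ] else fin 0)
                      ≡ fin (if lookup I′ j then centreCost X (Xc j) (lookup C j) else 0)
    pointwise j with lookup I′ j
    ... | true  = cost-[] X (Xc j) (lookup C j)
    ... | false = refl

  clustering-cost : ∀ {m n ℓ} (X : Vec (Pt m) n) Z (C : Vec (Pt m) ℓ) asg → IsClusteringOf X Z C asg →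
                    cost X Z C ≡ fin (sum (λ j → centreCost X (cluster Z asg j) (lookup C j)))
  clustering-cost X Z C asg clusters = trans (sym clusters) (Σ∞-fin _ (λ j → cost-[] X (cluster Z asg j) (lookup C j)))

module Splitting where
  open import Level using (0ℓ)
  open import Data.Bool using (Bool; true; false)
  open import Data.Nat using (zero; suc; _+_)
  open import Data.Fin using (zero; suc; _↑ˡ_; _↑ʳ_)
  open import Data.Fin.Properties using (+↔⊎)
  open import Data.Vec using ([]; _∷_; lookup; map)
  open import Data.Vec.Properties using (lookup-++ˡ; lookup-++ʳ; lookup-map; lookup∘tabulate; tabulate-∘;
                                         tabulate-cong; tabulate∘lookup; ∷-injectiveˡ; ∷-injectiveʳ)
  open import Data.Vec.Membership.Propositional using () renaming (_∈_ to _∈ᵥ_)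
  open import Data.Vec.Membership.Propositional.Properties using (∈-++⁺ˡ; ∈-++⁺ʳ; ∈-lookup)
  open import Function using (_∘_)
  open import Data.Sum using (_⊎_; inj₁; inj₂; [_,_]′)
  import Data.Sum as Sum
  open import Data.Sum.Algebra using (⊎-cong; ⊎-assoc)
  open import Data.Product using (_,_)
  open import Function.Bundles using (_↔_; Inverse; mk↔ₛ′)
  open import Function.Construct.Composition using (_↔-∘_)
  open import Function.Construct.Symmetry using (↔-sym)
  open import Function.Construct.Identity using (↔-id)
  open import Relation.Binary.PropositionalEquality

  splitIndex : ∀ {k} (I : Subset k) → Fin k → Fin ∣ I ∣ ⊎ Fin ∣ ∁ I ∣
  splitIndex (true ∷ I)  zero    = inj₁ zero
  splitIndex (true ∷ I)  (suc i) = Sum.map₁ suc (splitIndex I i)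
  splitIndex (false ∷ I) zero    = inj₂ zero
  splitIndex (false ∷ I) (suc i) = Sum.map₂ suc (splitIndex I i)

  joinIndex : ∀ {k} (I : Subset k) → Fin ∣ I ∣ ⊎ Fin ∣ ∁ I ∣ → Fin k
  joinIndex (true ∷ I)  (inj₁ zero)    = zero
  joinIndex (true ∷ I)  (inj₁ (suc x)) = suc (joinIndex I (inj₁ x))
  joinIndex (true ∷ I)  (inj₂ y)       = suc (joinIndex I (inj₂ y))
  joinIndex (false ∷ I) (inj₁ x)       = suc (joinIndex I (inj₁ x))
  joinIndex (false ∷ I) (inj₂ zero)    = zero
  joinIndex (false ∷ I) (inj₂ (suc y)) = suc (joinIndex I (inj₂ y))

  joinIndex-splitIndex : ∀ {k} (I : Subset k) i → joinIndex I (splitIndex I i) ≡ i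
  joinIndex-splitIndex (true ∷ I)  zero = refl
  joinIndex-splitIndex (false ∷ I) zero = refl
  joinIndex-splitIndex (true ∷ I)  (suc i) with splitIndex I i | joinIndex-splitIndex I i
  ... | inj₁ x | eq = cong suc eq
  ... | inj₂ y | eq = cong suc eq
  joinIndex-splitIndex (false ∷ I) (suc i) with splitIndex I i | joinIndex-splitIndex I i
  ... | inj₁ x | eq = cong suc eq
  ... | inj₂ y | eq = cong suc eq

  splitIndex-joinIndex : ∀ {k} (I : Subset k) s → splitIndex I (joinIndex I s) ≡ s
  splitIndex-joinIndex (true ∷ I)  (inj₁ zero)    = refl
  splitIndex-joinIndex (true ∷ I)  (inj₁ (suc x)) = cong (Sum.map₁ suc) (splitIndex-joinIndex I (inj₁ x))
  splitIndex-joinIndex (true ∷ I)  (inj₂ y)       = cong (Sum.map₁ suc) (splitIndex-joinIndex I (inj₂ y))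
  splitIndex-joinIndex (false ∷ I) (inj₁ x)       = cong (Sum.map₂ suc) (splitIndex-joinIndex I (inj₁ x))
  splitIndex-joinIndex (false ∷ I) (inj₂ zero)    = refl
  splitIndex-joinIndex (false ∷ I) (inj₂ (suc y)) = cong (Sum.map₂ suc) (splitIndex-joinIndex I (inj₂ y))

  split : ∀ {k} (I : Subset k) → Fin k ↔ (Fin ∣ I ∣ ⊎ Fin ∣ ∁ I ∣)
  split I = mk↔ₛ′ (splitIndex I) (joinIndex I) (splitIndex-joinIndex I) (joinIndex-splitIndex I)

  lookup-pick : ∀ {A : Set} {k} (I : Subset k) (t : Vec A k) i →
                lookup t i ≡ [ lookup (pick I t) , lookup (pick (∁ I) t) ]′ (splitIndex I i)
  lookup-pick (true ∷ I)  (a ∷ t) zero = refl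
  lookup-pick (false ∷ I) (a ∷ t) zero = refl
  lookup-pick (true ∷ I)  (a ∷ t) (suc i) with splitIndex I i | lookup-pick I t i
  ... | inj₁ x | eq = eq
  ... | inj₂ y | eq = eq
  lookup-pick (false ∷ I) (a ∷ t) (suc i) with splitIndex I i | lookup-pick I t i
  ... | inj₁ x | eq = eq
  ... | inj₂ y | eq = eq


  pick-map : ∀ {A B : Set} {k} (I : Subset k) (f : A → B) (u : Vec A k) → pick I (map f u) ≡ map f (pick I u)
  pick-map []          f []      = refl
  pick-map (true ∷ I)  f (a ∷ u) = cong (f a ∷_) (pick-map I f u)
  pick-map (false ∷ I) f (a ∷ u) = pick-map I f u

  pick-cong : ∀ {A : Set} {k} (I : Subset k) {u v : Vec A k} →
              (∀ j → lookup I j ≡ true → lookup u j ≡ lookup v j) → pick I u ≡ pick I v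
  pick-cong []          {[]}    {[]}    u≡v = refl
  pick-cong (true ∷ I)  {a ∷ u} {b ∷ v} u≡v = cong₂ _∷_ (u≡v zero refl) (pick-cong I (u≡v ∘ suc))
  pick-cong (false ∷ I) {a ∷ u} {b ∷ v} u≡v = pick-cong I (u≡v ∘ suc)

  pick-≡⇒lookup-≡ : ∀ {A : Set} {k} (I : Subset k) {u v : Vec A k} →
                    pick I u ≡ pick I v → ∀ j → lookup I j ≡ true → lookup u j ≡ lookup v j
  pick-≡⇒lookup-≡ (true ∷ I)  {a ∷ u} {b ∷ v} eq zero    _   = ∷-injectiveˡ eq
  pick-≡⇒lookup-≡ (true ∷ I)  {a ∷ u} {b ∷ v} eq (suc j) j∈I = pick-≡⇒lookup-≡ I (∷-injectiveʳ eq) j j∈I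
  pick-≡⇒lookup-≡ (false ∷ I) {a ∷ u} {b ∷ v} eq (suc j) j∈I = pick-≡⇒lookup-≡ I eq j j∈I
  lookup-∈-picks : ∀ {A : Set} {k l} (I : Subset k) (xs : Vec A l) (t : Vec A k) j →
                   lookup t j ∈ᵥ (xs ++ pick I t) ++ pick (∁ I) t
  lookup-∈-picks I xs t j with splitIndex I j | lookup-pick I t j
  ... | inj₁ x | t[j] = subst (_∈ᵥ _) (sym t[j]) (∈-++⁺ˡ (∈-++⁺ʳ xs (∈-lookup x (pick I t))))
  ... | inj₂ y | t[j] = subst (_∈ᵥ _) (sym t[j]) (∈-++⁺ʳ (xs ++ pick I t) (∈-lookup y (pick (∁ I) t)))

  [,]-lookup-map : ∀ {A B : Set} {p q} (f : A → B) (us : Vec A p) (ws : Vec A q) s →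
                   f ([ lookup us , lookup ws ]′ s) ≡ [ lookup (map f us) , lookup (map f ws) ]′ s
  [,]-lookup-map f us ws (inj₁ x) = sym (lookup-map x f us)
  [,]-lookup-map f us ws (inj₂ y) = sym (lookup-map y f ws)

  regroup : ∀ {k k₁} (I : Subset k) (σ : Fin ∣ I ∣ ↔ Fin k₁) (I′ : Subset ∣ ∁ I ∣) →
            Fin k ↔ Fin ((k₁ + ∣ I′ ∣) + ∣ ∁ I′ ∣)
  regroup I σ I′ = ↔-sym +↔⊎ ↔-∘ (⊎-cong (↔-sym +↔⊎) (↔-id _)
                              ↔-∘ (↔-sym (⊎-assoc 0ℓ _ _ _)
                              ↔-∘ (⊎-cong σ (split I′)
                              ↔-∘ split I)))


  lookup-regroup : ∀ {A : Set} {k k₁} (I : Subset k) (σ : Fin ∣ I ∣ ↔ Fin k₁) (I′ : Subset ∣ ∁ I ∣)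
                   (C₁ : Vec A k₁) (E : Vec A ∣ ∁ I ∣) i →
                   lookup ((C₁ ++ pick I′ E) ++ pick (∁ I′) E) (Inverse.to (regroup I σ I′) i)
                   ≡ [ lookup (reorder σ C₁) , lookup E ]′ (splitIndex I i)
  lookup-regroup {k₁ = k₁} I σ I′ C₁ E i with splitIndex I i
  ... | inj₁ x = trans (lookup-++ˡ (C₁ ++ pick I′ E) (pick (∁ I′) E) (Inverse.to σ x ↑ˡ ∣ I′ ∣))
                       (trans (lookup-++ˡ C₁ (pick I′ E) (Inverse.to σ x)) (sym (lookup∘tabulate _ x)))
  ... | inj₂ y with splitIndex I′ y | lookup-pick I′ E y
  ...   | inj₁ u | Ey = trans (lookup-++ˡ (C₁ ++ pick I′ E) (pick (∁ I′) E) (k₁ ↑ʳ u))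
                              (trans (lookup-++ʳ C₁ (pick I′ E) u) (sym Ey))
  ...   | inj₂ v | Ey = trans (lookup-++ʳ (C₁ ++ pick I′ E) (pick (∁ I′) E) v) (sym Ey)

  reduce-satSet : ∀ {m k k₁} (R : Rels m k) (I : Subset k) (σ : Fin ∣ I ∣ ↔ Fin k₁) (C₁ : Vec (Pt m) k₁)
                  (I′ : Subset ∣ ∁ I ∣) (E : Vec (Pt m) ∣ ∁ I ∣) →
                  Sat (reduce I (reorder σ C₁) R) E → SatSet R ((C₁ ++ pick I′ E) ++ pick (∁ I′) E)
  reduce-satSet {m} {k₁ = k₁} R I σ C₁ I′ E sat = regroup I σ I′ , λ j → column-sat j (sat j)
    where
    V : Vec (Pt m) ((k₁ + ∣ I′ ∣) + ∣ ∁ I′ ∣)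
    V = (C₁ ++ pick I′ E) ++ pick (∁ I′) E

    col : ∀ {s} → Fin m → Vec (Pt m) s → Vec Bool s
    col j = map (λ c → lookup c j)

    column-sat : ∀ j → reduce I (reorder σ C₁) R j (col j E) → R j (col j (reorder (regroup I σ I′) V))
    column-sat j (t , t∈R , t|I , t|∁I) = subst (R j) (sym column≡t) t∈R
      where
      entry : ∀ i → lookup (lookup V (Inverse.to (regroup I σ I′) i)) j ≡ lookup t i
      entry i = begin
        lookup (lookup V (Inverse.to (regroup I σ I′) i)) j
          ≡⟨ cong (λ v → lookup v j) (lookup-regroup I σ I′ C₁ E i) ⟩
        lookup ([ lookup (reorder σ C₁) , lookup E ]′ (splitIndex I i)) j
          ≡⟨ [,]-lookup-map (λ c → lookup c j) (reorder σ C₁) E (splitIndex I i) ⟩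
        [ lookup (col j (reorder σ C₁)) , lookup (col j E) ]′ (splitIndex I i)
          ≡⟨ cong₂ (λ u w → [ lookup u , lookup w ]′ (splitIndex I i)) t|I t|∁I ⟨
        [ lookup (pick I t) , lookup (pick (∁ I) t) ]′ (splitIndex I i)
          ≡⟨ lookup-pick I t i ⟨
        lookup t i ∎
        where open ≡-Reasoning
      column≡t : col j (reorder (regroup I σ I′) V) ≡ t
      column≡t = trans (sym (tabulate-∘ (λ c → lookup c j) (λ i → lookup V (Inverse.to (regroup I σ I′) i))))
                       (trans (tabulate-cong entry) (tabulate∘lookup t))


module Repair {m ℓ} (R : Rels m ℓ) (I′ : Subset ℓ) (C C′ : Vec (Pt m) ℓ)
              (C-sat : Sat R C) (C′-sat : Sat (proj I′ R) (pick I′ C′)) where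
  open import Data.Bool using (Bool; true)
  open import Data.Nat using (_≤_; _≟_; z≤n)
  open import Data.Nat.Properties using (≤-trans; ≤-reflexive; n≢0⇒n>0; module ≤-Reasoning)
  open import Data.Vec using (lookup; tabulate; map)
  open import Data.Vec.Properties using (lookup-map; lookup∘tabulate; tabulate-cong; tabulate∘lookup; tabulate-∘)
  open import Data.Product using (proj₁; proj₂)
  open import Relation.Nullary using (Dec; yes; no)
  open import Relation.Binary.PropositionalEquality
  open Sums
  open Costs
  open Splitting

  col : ∀ {s} → Fin m → Vec (Pt m) s → Vec Bool s
  col c = map (λ y → lookup y c)

  bit : Vec (Pt m) ℓ → Fin ℓ → Fin m → Bool
  bit Y y c = lookup (lookup Y y) c

  mismatch : Fin m → ℕ
  mismatch c = sumOver I′ (λ y → bitDiff (bit C′ y c) (bit C y c))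

  -- Coordinates on which C′ already agrees with C over I′ are copied from C; every other coordinate
  -- is a tuple of R witnessing the projected constraint, so each centre moves by at most the number
  -- of such coordinates.
  column : ∀ c → Dec (mismatch c ≡ 0) → Vec Bool ℓ
  column c (yes _) = col c C
  column c (no _)  = proj₁ (C′-sat c)

  repaired : Vec (Pt m) ℓ
  repaired = tabulate (λ j → tabulate (λ c → lookup (column c (mismatch c ≟ 0)) j))

  bit-repaired : ∀ j c → bit repaired j c ≡ lookup (column c (mismatch c ≟ 0)) j
  bit-repaired j c = trans (cong (λ y → lookup y c) (lookup∘tabulate _ j)) (lookup∘tabulate _ c)

  col-repaired : ∀ c → col c repaired ≡ column c (mismatch c ≟ 0)
  col-repaired c = trans (sym (tabulate-∘ (λ y → lookup y c) (λ j → tabulate (λ c′ → lookup (column c′ (mismatch c′ ≟ 0)) j))))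
                         (trans (tabulate-cong (λ j → lookup∘tabulate _ c)) (tabulate∘lookup _))

  repaired-sat : Sat R repaired
  repaired-sat c = subst (R c) (sym (col-repaired c)) (column-sat (mismatch c ≟ 0))
    where
    column-sat : ∀ d → R c (column c d)
    column-sat (yes _) = C-sat c
    column-sat (no _)  = proj₁ (proj₂ (C′-sat c))

  repaired-agrees : ∀ j → lookup I′ j ≡ true → lookup repaired j ≡ lookup C′ j
  repaired-agrees j j∈I′ = trans (sym (tabulate∘lookup (lookup repaired j)))
    (trans (tabulate-cong (λ c → trans (bit-repaired j c) (column-agrees c (mismatch c ≟ 0))))
           (tabulate∘lookup (lookup C′ j)))
    where
    column-agrees : ∀ c d → lookup (column c d) j ≡ bit C′ j c
    column-agrees c (yes none) = trans (lookup-map j (λ y → lookup y c) C)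
      (sym (bitDiff≡0⇒≡ (subst (bitDiff (bit C′ j c) (bit C j c) ≤_) none
        (≤-sumOver I′ (λ y → bitDiff (bit C′ y c) (bit C y c)) j j∈I′))))
    column-agrees c (no _) = trans
      (pick-≡⇒lookup-≡ I′ (trans (proj₂ (proj₂ (C′-sat c))) (sym (pick-map I′ (λ y → lookup y c) C′))) j j∈I′)
      (lookup-map j (λ y → lookup y c) C′)

  repaired-close : ∀ j → dH (lookup C j) (lookup repaired j) ≤ sumOver I′ (λ y → dH (lookup C′ y) (lookup C y))
  repaired-close j = begin
    dH (lookup C j) (lookup repaired j)
      ≡⟨ dH-sum (lookup C j) (lookup repaired j) ⟩
    sum (λ c → bitDiff (bit C j c) (bit repaired j c))
      ≤⟨ sum-mono-≤ (λ c → subst (λ b → bitDiff (bit C j c) b ≤ mismatch c) (sym (bit-repaired j c))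
                                 (column-close c (mismatch c ≟ 0))) ⟩
    sum mismatch
      ≡⟨ sum-sumOver-comm I′ (λ y c → bitDiff (bit C′ y c) (bit C y c)) ⟩
    sumOver I′ (λ y → sum (λ c → bitDiff (bit C′ y c) (bit C y c)))
      ≤⟨ sumOver-mono-≤ I′ (λ y _ → ≤-reflexive (sym (dH-sum (lookup C′ y) (lookup C y)))) ⟩
    sumOver I′ (λ y → dH (lookup C′ y) (lookup C y)) ∎
    where
    open ≤-Reasoning
    column-close : ∀ c d → bitDiff (bit C j c) (lookup (column c d) j) ≤ mismatch c
    column-close c (yes _) = ≤-trans (≤-reflexive (trans (cong (bitDiff (bit C j c)) (lookup-map j (λ y → lookup y c) C))
                                                         (bitDiff-self (bit C j c)))) z≤n
    column-close c (no ≢0) = ≤-trans (bitDiff-≤1 (bit C j c) _) (n≢0⇒n>0 ≢0)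

module ReassignmentCost {m n ℓ} (X : Vec (Pt m) n) (Xc : Fin ℓ → Subset n) (I′ : Subset ℓ)
                        (C C′ E : Vec (Pt m) ℓ) where
  open import Data.Bool using (true)
  open import Data.Nat using (_+_; _*_; _≤_; NonZero)
  open import Data.Nat.Properties
  open import Data.Nat.Solver using (module +-*-Solver)
  open import Data.Vec using (lookup)
  open import Data.Fin.Subset.Properties using (∣p∣≤n)
  open import Algebra.Properties.CommutativeSemigroup *-commutativeSemigroup using (x∙yz≈y∙xz)
  open import Relation.Binary.PropositionalEquality
  open +-*-Solver
  open Sums
  open Costs

  clusterCost : Vec (Pt m) ℓ → Fin ℓ → ℕ
  clusterCost Y j = centreCost X (Xc j) (lookup Y j)

  heavyCost lightCost : Vec (Pt m) ℓ → ℕ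
  heavyCost Y = sumOver I′ (clusterCost Y)
  lightCost Y = sumOver (∁ I′) (clusterCost Y)

  shift : ℕ
  shift = sumOver I′ (λ y → dH (lookup C′ y) (lookup C y))

  shiftCost : ℕ
  shiftCost = sumOver (∁ I′) (λ j → ∣ Xc j ∣ * shift)

  repaired-cost-≤ : (∀ j → lookup I′ j ≡ true → lookup E j ≡ lookup C′ j) →
                    (∀ j → dH (lookup C j) (lookup E j) ≤ shift) →
                    sum (clusterCost E) ≤ heavyCost C′ + (lightCost C + shiftCost)
  repaired-cost-≤ agrees close = begin
    sum (clusterCost E)
      ≡⟨ sumOver-split I′ (clusterCost E) ⟩
    heavyCost E + lightCost E
      ≤⟨ +-mono-≤ (sumOver-mono-≤ I′ (λ j j∈I′ → ≤-reflexive (cong (centreCost X (Xc j)) (agrees j j∈I′))))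
                  (sumOver-mono-≤ (∁ I′) (λ j _ → moved j)) ⟩
    heavyCost C′ + sumOver (∁ I′) (λ j → clusterCost C j + ∣ Xc j ∣ * shift)
      ≡⟨ cong (heavyCost C′ +_) (sumOver-+ (∁ I′) (clusterCost C) (λ j → ∣ Xc j ∣ * shift)) ⟩
    heavyCost C′ + (lightCost C + shiftCost) ∎
    where
    open ≤-Reasoning
    moved : ∀ j → clusterCost E j ≤ clusterCost C j + ∣ Xc j ∣ * shift
    moved j = ≤-trans (centreCost-shift X (Xc j) (lookup C j) (lookup E j))
                      (+-monoʳ-≤ (clusterCost C j) (*-monoʳ-≤ ∣ Xc j ∣ (close j)))

  -- Moving the centre of a light cluster j by shift costs ∣ Xc j ∣ · Σ_y dH(C′ y, C y), and each
  -- term is paid for by the heavy cluster y, which is k/α times larger; at most k clusters are light.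
  shiftCost-≤ : ∀ q p k .{{_ : NonZero k}} → ℓ ≤ k →
                (∀ y j → lookup I′ y ≡ true → lookup (∁ I′) j ≡ true → q * (k * ∣ Xc j ∣) ≤ p * ∣ Xc y ∣) →
                q * shiftCost ≤ p * (heavyCost C′ + heavyCost C)
  shiftCost-≤ q p k ℓ≤k heavy = *-cancelˡ-≤ k (begin
    k * (q * shiftCost)                                  ≡⟨ x∙yz≈y∙xz k q shiftCost ⟩
    q * (k * shiftCost)                                  ≡⟨ cong (q *_) (*-distribˡ-sumOver k (∁ I′) _) ⟩
    q * sumOver (∁ I′) (λ j → k * (∣ Xc j ∣ * shift))    ≡⟨ *-distribˡ-sumOver q (∁ I′) _ ⟩
    sumOver (∁ I′) (λ j → q * (k * (∣ Xc j ∣ * shift)))  ≤⟨ sumOver-mono-≤ (∁ I′) light ⟩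
    sumOver (∁ I′) (λ _ → p * H)                         ≡⟨ sumOver-const (∁ I′) (p * H) ⟩
    ∣ ∁ I′ ∣ * (p * H)                                   ≤⟨ *-monoˡ-≤ (p * H) (≤-trans (∣p∣≤n (∁ I′)) ℓ≤k) ⟩
    k * (p * H)                                          ∎)
    where
    open ≤-Reasoning
    H : ℕ
    H = heavyCost C′ + heavyCost C
    light : ∀ j → lookup (∁ I′) j ≡ true → q * (k * (∣ Xc j ∣ * shift)) ≤ p * H
    light j j∉I′ = begin
      q * (k * (∣ Xc j ∣ * shift))                                ≡⟨ solve 4 (λ q k x s → q :* (k :* (x :* s)) := (q :* (k :* x)) :* s) refl q k ∣ Xc j ∣ shift ⟩
      q * (k * ∣ Xc j ∣) * shift                                  ≡⟨ *-distribˡ-sumOver (q * (k * ∣ Xc j ∣)) I′ _ ⟩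
      sumOver I′ (λ y → q * (k * ∣ Xc j ∣) * dH (lookup C′ y) (lookup C y))  ≤⟨ sumOver-mono-≤ I′ heavy-y ⟩
      sumOver I′ (λ y → p * (clusterCost C′ y + clusterCost C y)) ≡⟨ *-distribˡ-sumOver p I′ _ ⟨
      p * sumOver I′ (λ y → clusterCost C′ y + clusterCost C y)   ≡⟨ cong (p *_) (sumOver-+ I′ (clusterCost C′) (clusterCost C)) ⟩
      p * H                                                       ∎
      where
      heavy-y : ∀ y → lookup I′ y ≡ true →
                q * (k * ∣ Xc j ∣) * dH (lookup C′ y) (lookup C y) ≤ p * (clusterCost C′ y + clusterCost C y)
      heavy-y y y∈I′ = begin
        q * (k * ∣ Xc j ∣) * dH (lookup C′ y) (lookup C y) ≤⟨ *-monoˡ-≤ _ (heavy y j y∈I′ j∉I′) ⟩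
        p * ∣ Xc y ∣ * dH (lookup C′ y) (lookup C y)       ≡⟨ *-assoc p ∣ Xc y ∣ _ ⟩
        p * (∣ Xc y ∣ * dH (lookup C′ y) (lookup C y))     ≤⟨ *-monoʳ-≤ p (centreCost-pair X (Xc y) (lookup C′ y) (lookup C y)) ⟩
        p * (clusterCost C′ y + clusterCost C y)           ∎

  -- With α = p/q: Hp ≤ (1 + α) Hs ≤ 2 Hs, so N ≤ Hp + Ls + α (Hp + Hs) ≤ (1 + 4α) Hs + Ls.
  cleared-approx : ∀ q p Hp Hs Ls S N .{{_ : NonZero q}} → p ≤ q → N ≤ Hp + (Ls + S) →
                   q * Hp ≤ (q + p) * Hs → q * S ≤ p * (Hp + Hs) → q * N ≤ (q + 4 * p) * (Hs + Ls)
  cleared-approx q p Hp Hs Ls S N p≤q N≤ near qS≤ = begin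
    q * N                                      ≤⟨ *-monoʳ-≤ q N≤ ⟩
    q * (Hp + (Ls + S))                        ≡⟨ solve 4 (λ q a b c → q :* (a :+ (b :+ c)) := q :* a :+ q :* b :+ q :* c) refl q Hp Ls S ⟩
    q * Hp + q * Ls + q * S                    ≤⟨ +-mono-≤ (+-monoˡ-≤ (q * Ls) near) qS≤ ⟩
    (q + p) * Hs + q * Ls + p * (Hp + Hs)      ≤⟨ +-monoʳ-≤ ((q + p) * Hs + q * Ls) (*-monoʳ-≤ p (+-monoˡ-≤ Hs Hp≤2Hs)) ⟩
    (q + p) * Hs + q * Ls + p * (2 * Hs + Hs)  ≡⟨ solve 4 (λ q p h l → (q :+ p) :* h :+ q :* l :+ p :* (con 2 :* h :+ h)
                                                              := (q :+ con 4 :* p) :* h :+ q :* l) refl q p Hs Ls ⟩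
    (q + 4 * p) * Hs + q * Ls                  ≤⟨ +-monoʳ-≤ ((q + 4 * p) * Hs) (*-monoˡ-≤ Ls (m≤m+n q (4 * p))) ⟩
    (q + 4 * p) * Hs + (q + 4 * p) * Ls        ≡⟨ *-distribˡ-+ (q + 4 * p) Hs Ls ⟨
    (q + 4 * p) * (Hs + Ls)                    ∎
    where
    open ≤-Reasoning
    Hp≤2Hs : Hp ≤ 2 * Hs
    Hp≤2Hs = *-cancelˡ-≤ q (begin
      q * Hp        ≤⟨ near ⟩
      (q + p) * Hs  ≤⟨ *-monoˡ-≤ Hs (+-monoʳ-≤ q p≤q) ⟩
      (q + q) * Hs  ≡⟨ solve 2 (λ q h → (q :+ q) :* h := q :* (con 2 :* h)) refl q Hs ⟩
      q * (2 * Hs)  ∎)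

  reassignment-cost-≤ : ∀ q p k .{{_ : NonZero q}} .{{_ : NonZero k}} → ℓ ≤ k → p ≤ q →
    (∀ y j → lookup I′ y ≡ true → lookup (∁ I′) j ≡ true → q * (k * ∣ Xc j ∣) ≤ p * ∣ Xc y ∣) →
    q * heavyCost C′ ≤ (q + p) * heavyCost C →
    (∀ j → lookup I′ j ≡ true → lookup E j ≡ lookup C′ j) →
    (∀ j → dH (lookup C j) (lookup E j) ≤ shift) →
    q * sum (clusterCost E) ≤ (q + 4 * p) * sum (clusterCost C)
  reassignment-cost-≤ q p k ℓ≤k p≤q heavy near agrees close =
    subst (λ T → q * sum (clusterCost E) ≤ (q + 4 * p) * T) (sym (sumOver-split I′ (clusterCost C)))
          (cleared-approx q p (heavyCost C′) (heavyCost C) (lightCost C) shiftCost (sum (clusterCost E))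
                          p≤q (repaired-cost-≤ agrees close) near (shiftCost-≤ q p k ℓ≤k heavy))

open import Data.Nat as ℕ using ()
open import Data.Integer using (+_)
open import Data.Rational using (ℚ; 0ℚ; 1ℚ; _/_; _+_; _*_; _÷_; _≤_; _<_; >-nonZero)
open import Function.Bundles using (_↔_)
open import Data.Bool using (true)
import Data.Nat.Properties as ℕ
open import Data.Nat.Solver using (module +-*-Solver)
import Data.Rational.Properties as ℚ
open import Data.Fin.Subset.Properties using (∣p∣≤n; x∈∁p⇒x∉p)
open import Data.Vec using (lookup)
open import Data.Vec.Properties using (lookup⇒[]=)
open import Data.Vec.Membership.Propositional using () renaming (_∈_ to _∈ᵥ_)
open import Data.Product using (_,_)
open import Data.Unit using (tt)
open import Function.Bundles using (Equivalence)
open import Relation.Binary.PropositionalEquality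
open Rationals
open Sums
open Costs
open Splitting

near-cleared : ∀ {α} → 0ℚ ≤ α → ∀ a b → ScaledLE 1ℚ (fin a) (1ℚ + α) (fin b) →
               den α ℕ.* a ℕ.≤ (den α ℕ.+ num α) ℕ.* b
near-cleared {α} 0≤α a b a≤ = subst (λ c → den α ℕ.* a ℕ.≤ (den α ℕ.+ c) ℕ.* b) (ℕ.*-identityˡ (num α))
  (Equivalence.to (≤-cleared 0≤α 1 a b)
    (subst₂ _≤_ (ℚ.*-identityˡ (toℚ a)) (cong (λ z → (1ℚ + z) * toℚ b) (sym (ℚ.*-identityˡ α))) a≤))

heavy-cleared : ∀ {n ℓ α} (0<α : 0ℚ < α) k (Xc : Fin ℓ → Subset n) I′ →
                IsHeavy ((toℚ k ÷ α) {{>-nonZero 0<α}}) Xc I′ →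
                ∀ y j → lookup I′ y ≡ true → lookup (∁ I′) j ≡ true →
                den α ℕ.* (k ℕ.* ∣ Xc j ∣) ℕ.≤ num α ℕ.* ∣ Xc y ∣
heavy-cleared 0<α k Xc I′ heavy y j y∈I′ j∈∁I′ = <-÷-cleared 0<α k ∣ Xc j ∣ ∣ Xc y ∣
  (heavy y j (lookup⇒[]= y I′ y∈I′) (x∈∁p⇒x∉p (lookup⇒[]= j (∁ I′) j∈∁I′)))

extension-bound : ∀ {α δ} → 0ℚ ≤ α → α ≤ 1ℚ → 0ℚ ≤ δ → ∀ {b z b′ w} T N o →
                  ScaledLE 1ℚ (b ⊕ (z ⊕ fin T)) (1ℚ + δ) o → b′ ≤∞ b → w ≤∞ (z ⊕ fin N) →
                  den α ℕ.* N ℕ.≤ (den α ℕ.+ 4 ℕ.* num α) ℕ.* T →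
                  ScaledLE 1ℚ (b′ ⊕ w) (1ℚ + ((+ 5 / 1) * δ + (+ 4 / 1) * α)) o
extension-bound _ _ _ T N ∞ _ _ _ _ = tt
extension-bound {α} {δ} 0≤α α≤1 0≤δ {fin b} {fin z} {fin b′} {fin w} T N (fin o) old≤ b′≤b w≤z+N N≤ =
  subst (_≤ _) (sym (ℚ.*-identityˡ (toℚ (b′ ℕ.+ w))))
    (≤-approx-trans 0≤α 4 α≤1 0≤δ (ℚ.nonNegative⁻¹ _ {{toℚ-nonNeg o}})
      (Equivalence.from (≤-cleared 0≤α 4 (b′ ℕ.+ w) (b ℕ.+ (z ℕ.+ T))) new≤)
      (subst (_≤ _) (ℚ.*-identityˡ (toℚ (b ℕ.+ (z ℕ.+ T)))) old≤))
  where
  open ℕ.≤-Reasoning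
  open +-*-Solver
  q c : ℕ
  q = den α
  c = den α ℕ.+ 4 ℕ.* num α
  new≤ : q ℕ.* (b′ ℕ.+ w) ℕ.≤ c ℕ.* (b ℕ.+ (z ℕ.+ T))
  new≤ = begin
    q ℕ.* (b′ ℕ.+ w)                  ≤⟨ ℕ.*-monoʳ-≤ q (ℕ.+-mono-≤ b′≤b w≤z+N) ⟩
    q ℕ.* (b ℕ.+ (z ℕ.+ N))           ≡⟨ solve 4 (λ q b z n → q :* (b :+ (z :+ n)) := q :* (b :+ z) :+ q :* n) refl q b z N ⟩
    q ℕ.* (b ℕ.+ z) ℕ.+ q ℕ.* N       ≤⟨ ℕ.+-mono-≤ (ℕ.*-monoˡ-≤ (b ℕ.+ z) (ℕ.m≤m+n q (4 ℕ.* num α))) N≤ ⟩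
    c ℕ.* (b ℕ.+ z) ℕ.+ c ℕ.* T       ≡⟨ solve 4 (λ c b z t → c :* (b :+ z) :+ c :* t := c :* (b :+ (z :+ t))) refl c b z T ⟩
    c ℕ.* (b ℕ.+ (z ℕ.+ T))           ∎
extension-bound _ _ _ {∞}                           T N (fin o) ()
extension-bound _ _ _ {fin b} {∞}                   T N (fin o) ()
extension-bound _ _ _ {fin b} {fin z} {∞}           T N (fin o) _ ()
extension-bound _ _ _ {fin b} {fin z} {fin b′} {∞}  T N (fin o) _ _ ()

lemma9 : ∀ {m n k k₁ : ℕ} (X : Vec (Pt m) n) (R : Rels m k)
  (δ α δ' : ℚ) (0≤δ : 0ℚ ≤ δ) (0<α : 0ℚ < α) (α≤1 : α ≤ 1ℚ) (δ≤δ' : δ ≤ δ') →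
  Irreducible X R k ((+ 5 / 1) * δ') →
  (C₁ : Vec (Pt m) k₁) (B : Subset n) → k₁ ℕ.< k →
  Extendable δ X R C₁ B →
  (I : Subset k) (σ : Fin ∣ I ∣ ↔ Fin k₁) (C₂ : Vec (Pt m) ∣ ∁ I ∣) (Z₁ Z₂ : Subset n) →
  IsGoodExtensionBy δ X R C₁ B I σ C₂ Z₁ Z₂ →
  Sat (reduce I (reorder σ C₁) R) C₂ →
  (asg : Fin n → Fin ∣ ∁ I ∣) → IsClusteringOf X Z₂ C₂ asg →
  (I' : Subset ∣ ∁ I ∣) →
  IsHeavy ((toℚ k ÷ α) {{>-nonZero 0<α}}) (cluster Z₂ asg) I' →
  (C₂' : Vec (Pt m) ∣ ∁ I ∣) →
  Sat (proj I' (reduce I (reorder σ C₁) R)) (pick I' C₂') →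
  ScaledLE 1ℚ (costOn X (cluster Z₂ asg) I' C₂') (1ℚ + α) (costOn X (cluster Z₂ asg) I' C₂) →
  Extendable ((+ 5 / 1) * δ + (+ 4 / 1) * α) X R (C₁ ++ pick I' C₂') B
lemma9 {m} {k = k} {k₁} X R δ α δ′ 0≤δ 0<α α≤1 _ _ C₁ B k₁<k _ I σ C₂ Z₁ Z₂
  ((_ , extension-cost) , _ , Z₁∪Z₂≡∁B , cost-split , _ , _) C₂-sat asg clusters I′ heavy C₂′ C₂′-sat near =
  ∣ ∁ I′ ∣ , pick (∁ I′) E , satisfied , bound
  where
  open Repair (reduce I (reorder σ C₁) R) I′ C₂ C₂′ C₂-sat C₂′-sat
    using (repaired-sat; repaired-agrees; repaired-close) renaming (repaired to E)
  open ReassignmentCost X (cluster Z₂ asg) I′ C₂ C₂′ E using (clusterCost; reassignment-cost-≤)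
  0≤α : 0ℚ ≤ α
  0≤α = ℚ.<⇒≤ 0<α
  P : Vec (Pt m) ∣ I′ ∣
  P = pick I′ C₂′
  V : Vec (Pt m) ((k₁ ℕ.+ ∣ I′ ∣) ℕ.+ ∣ ∁ I′ ∣)
  V = (C₁ ++ P) ++ pick (∁ I′) E
  instance
    k≢0 : ℕ.NonZero k
    k≢0 = ℕ.>-nonZero (ℕ.<-≤-trans (ℕ.s≤s ℕ.z≤n) k₁<k)
    den≢0 : ℕ.NonZero (den α)
    den≢0 = den-nonZero α

  picks-agree : pick I′ E ≡ P
  picks-agree = pick-cong I′ repaired-agrees

  satisfied : SatSet R V
  satisfied = subst (λ Q → SatSet R ((C₁ ++ Q) ++ pick (∁ I′) E)) picks-agree (reduce-satSet R I σ C₁ I′ E repaired-sat)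

  reassigned : cost X (∁ B) V ≤∞ (cost X Z₁ C₁ ⊕ fin (sum (clusterCost E)))
  reassigned = subst (λ A → cost X A V ≤∞ (cost X Z₁ C₁ ⊕ fin (sum (clusterCost E)))) Z₁∪Z₂≡∁B
    (≤∞-trans (cost-∪-≤ X Z₁ Z₂ asg V E E∈V)
              (⊕-mono-≤∞ (≤∞-trans (cost-++ˡ X Z₁ (C₁ ++ P) (pick (∁ I′) E)) (cost-++ˡ X Z₁ C₁ P)) ℕ.≤-refl))
    where
    E∈V : ∀ j → lookup E j ∈ᵥ V
    E∈V j = subst (λ Q → lookup E j ∈ᵥ (C₁ ++ Q) ++ pick (∁ I′) E) picks-agree (lookup-∈-picks I′ C₁ E j)

  cheaper : den α ℕ.* sum (clusterCost E) ℕ.≤ (den α ℕ.+ 4 ℕ.* num α) ℕ.* sum (clusterCost C₂)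
  cheaper = reassignment-cost-≤ (den α) (num α) k (∣p∣≤n (∁ I)) (num≤den 0≤α α≤1)
    (heavy-cleared 0<α k (cluster Z₂ asg) I′ heavy)
    (near-cleared 0≤α _ _ (subst₂ (λ a b → ScaledLE 1ℚ a (1ℚ + α) b)
      (costOn-fin X (cluster Z₂ asg) I′ C₂′) (costOn-fin X (cluster Z₂ asg) I′ C₂) near))
    repaired-agrees repaired-close

  bound : ∀ o → IsOPT X Data.Fin.Subset.⊤ R o →
          ScaledLE 1ℚ (cost X B (C₁ ++ P) ⊕ cost X (∁ B) V) (1ℚ + ((+ 5 / 1) * δ + (+ 4 / 1) * α)) o
  bound o opt = extension-bound 0≤α α≤1 0≤δ _ _ o
    (subst (λ c → ScaledLE 1ℚ (cost X B C₁ ⊕ c) (1ℚ + δ) o)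
      (trans cost-split (cong (cost X Z₁ C₁ ⊕_) (clustering-cost X Z₂ C₂ asg clusters))) (extension-cost o opt))
    (cost-++ˡ X B C₁ P) reassigned cheaper
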